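{- Let $k\ge 3$ and let $G=C_3(1;1,k;2,k)$. Let $A_0=\{k+9,\,2k+11,\,2k+14,\,3k+14,\,4k+16\}$, $A_1=A_0+1$, $A=A_0\cup A_1$, and $B=\{i^2:\ i\in\{3,4,\ldots,k+3\}\}$. If $A\cap B=\emptyset$, then $G$ is transmission irregular.
   Context: The transmission of a vertex $v$ of a graph $G$ is ${\rm Tr}_G(v)=\sum_{u\in V(G)} d_G(u,v)$; $G$ is transmission irregular if all its vertices have pairwise different transmissions. For a set of integers $X$ and integer $c$, $X+c=\{x+c: x\in X\}$. The graph $C_3(k_1;k_2,k_3;k_4,k_5)$ is obtained from a triangle $C_3$ by attaching at one vertex of the triangle a pendant path of length $k_1$, at a second vertex two pendant paths of lengths $k_2$ and $k_3$, and at the third vertex two pendant paths of lengths $k_4$ and $k_5$. -}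

module Defs where

open import Data.Nat using (ℕ; zero; suc; _+_; _*_; _≤_)
open import Data.Fin using (Fin; toℕ)
open import Data.Fin.Patterns using (0F; 1F; 2F; 3F; 4F)
open import Data.List using (List; []; _∷_; _++_; map; concatMap; allFin)
open import Data.Nat.ListAction using (sum)
open import Data.Product using (Σ; _,_; _×_)
open import Data.Sum using (_⊎_; inj₁; inj₂)
open import Relation.Binary.PropositionalEquality using (_≡_)

-- Finite graphs: a vertex type, a (symmetric) adjacency relation and
-- a list enumerating every vertex exactly once.

record Graph : Set₁ where
  field
    V        : Set
    Adj      : V → V → Set
    vertices : List V
open Graph public

data Walk (G : Graph) : V G → V G → ℕ → Set where
  nil  : ∀ {u} → Walk G u u 0
  cons : ∀ {u w v ℓ} → Adj G u w → Walk G w v ℓ → Walk G u v (suc ℓ)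

record IsDist (G : Graph) (u v : V G) (d : ℕ) : Set where
  field
    walk     : Walk G u v d
    shortest : ∀ {ℓ} → Walk G u v ℓ → d ≤ ℓ

IsDistanceFunction : (G : Graph) → (V G → V G → ℕ) → Set
IsDistanceFunction G δ = ∀ u v → IsDist G u v (δ u v)

Tr : (G : Graph) → (V G → V G → ℕ) → V G → ℕ
Tr G δ v = sum (map (λ u → δ u v) (vertices G))

TransmissionIrregularWrt : (G : Graph) → (V G → V G → ℕ) → Set
TransmissionIrregularWrt G δ = ∀ u v → Tr G δ u ≡ Tr G δ v → u ≡ v

-- G is transmission irregular (the distance function exists and is unique,
-- so we state existence of the distance function together with irregularity).
TransmissionIrregular : Graph → Set
TransmissionIrregular G =
  Σ (V G → V G → ℕ) λ δ → IsDistanceFunction G δ × TransmissionIrregularWrt G δ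

-- Pendant path p ∈ Fin 5 has length len p and
-- is attached at triangle vertex att p; its vertices (p , i), i < len p,
-- with (p , 0) adjacent to the triangle vertex and (p , i) ~ (p , i+1).

att : Fin 5 → Fin 3
att 0F = 0F
att 1F = 1F
att 2F = 1F
att 3F = 2F
att 4F = 2F

lenC3 : ℕ → ℕ → ℕ → ℕ → ℕ → Fin 5 → ℕ
lenC3 k1 k2 k3 k4 k5 0F = k1
lenC3 k1 k2 k3 k4 k5 1F = k2
lenC3 k1 k2 k3 k4 k5 2F = k3
lenC3 k1 k2 k3 k4 k5 3F = k4
lenC3 k1 k2 k3 k4 k5 4F = k5

VC3 : (Fin 5 → ℕ) → Set
VC3 len = Fin 3 ⊎ Σ (Fin 5) (λ p → Fin (len p))

data EdgeC3 (len : Fin 5 → ℕ) : VC3 len → VC3 len → Set where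
  tri01  : EdgeC3 len (inj₁ 0F) (inj₁ 1F)
  tri12  : EdgeC3 len (inj₁ 1F) (inj₁ 2F)
  tri02  : EdgeC3 len (inj₁ 0F) (inj₁ 2F)
  attach : ∀ p (i : Fin (len p)) → toℕ i ≡ 0 →
           EdgeC3 len (inj₁ (att p)) (inj₂ (p , i))
  step   : ∀ p (i j : Fin (len p)) → suc (toℕ i) ≡ toℕ j →
           EdgeC3 len (inj₂ (p , i)) (inj₂ (p , j))

AdjC3 : (len : Fin 5 → ℕ) → VC3 len → VC3 len → Set
AdjC3 len u v = EdgeC3 len u v ⊎ EdgeC3 len v u

verticesC3 : (len : Fin 5 → ℕ) → List (VC3 len)
verticesC3 len =
  map inj₁ (allFin 3) ++
  concatMap (λ p → map (λ i → inj₂ (p , i)) (allFin (len p))) (allFin 5)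

C3 : ℕ → ℕ → ℕ → ℕ → ℕ → Graph
C3 k1 k2 k3 k4 k5 = record
  { V        = VC3 (lenC3 k1 k2 k3 k4 k5)
  ; Adj      = AdjC3 (lenC3 k1 k2 k3 k4 k5)
  ; vertices = verticesC3 (lenC3 k1 k2 k3 k4 k5)
  }

A0 : ℕ → List ℕ
A0 k = k + 9 ∷ 2 * k + 11 ∷ 2 * k + 14 ∷ 3 * k + 14 ∷ 4 * k + 16 ∷ []

Aset : ℕ → List ℕ
Aset k = A0 k ++ map suc (A0 k)

module Submission where

-- The distance in C₃(len) is written down explicitly (δ below): inside one
-- pendant path it is the difference of depths, otherwise a shortest route
-- climbs to the triangle, crosses at most one triangle edge and descends.
-- That δ is the graph distance follows from two facts: δ changes by at most
-- one along every edge (so every walk is at least as long), and for every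
-- pair of vertices a walk of length δ is constructed.
--
-- The transmission of a vertex is then split into its distance sum to the
-- seven "core" vertices (triangle and paths of length 1, 1, 2), which is a
-- numeral for every core vertex and is shifted by 7·(depth) along a long
-- path, plus the contributions of the two long paths, given by triangular
-- numbers T and by sums of |x - J|.  This yields, with K = (k+1)²,
--   Tr(core vertex) = K + one of 8, 9, k+9, 2k+11, 2k+14, 3k+14, 4k+16,
--   Tr(depth J+1 on the first / second long path) = K + (J+4)² / K + (J+4)² - 1.
-- The seven core values form the increasing list 8 ∷ 9 ∷ A₀, so they are
-- distinct; squares are distinct and never consecutive; and the hypothesis
-- A ∩ B = ∅ implies that no element of A₀ is a square (J+4)² (J < k), nor one
-- less than such a square.  Hence the transmission determines the vertex.

open import Defs
open import Data.Nat using (ℕ; zero; suc; pred; _+_; _*_; _∸_; _≤_; _<_; ∣_-_∣; z≤n; s≤s; z<s)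
open import Data.Nat.Properties
open import Data.Nat.ListAction using (sum)
open import Data.Nat.ListAction.Properties using (sum-++)
open import Data.Nat.Tactic.RingSolver using (solve-∀; solve)
open import Algebra.Properties.CommutativeSemigroup +-commutativeSemigroup
  using (interchange; xy∙z≈xz∙y; xy∙z≈x∙zy)
open import Data.Fin using (Fin; toℕ; fromℕ<)
import Data.Fin as Fin
open import Data.Fin.Properties using (toℕ-injective; toℕ<n; toℕ-fromℕ<)
open import Data.Fin.Patterns using (0F; 1F; 2F; 3F; 4F; 5F; 6F)
open import Data.Bool using (if_then_else_)
open import Data.List using (List; []; _∷_; _++_; map; concat; allFin; tabulate; length; lookup)
open import Data.List.Properties using (map-∘; map-cong; map-++; map-tabulate)
open import Data.List.Membership.Propositional using (_∈_)
open import Data.List.Membership.Propositional.Properties using (∈-lookup; ∈-map⁺; ∈-++⁺ˡ; ∈-++⁺ʳ)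
open import Data.List.Relation.Unary.All as All using (All)
open import Data.List.Relation.Unary.Linked as Linked using (Linked)
open import Data.Product using (_,_; _×_; proj₁; proj₂)
open import Data.Sum using (inj₁; inj₂)
open import Data.Unit using (⊤; tt)
open import Data.Empty using (⊥-elim)
open import Relation.Nullary using (¬_; does; yes; no)
open import Relation.Binary using (tri<; tri≈; tri>)
open import Relation.Binary.PropositionalEquality
  using (_≡_; _≢_; refl; sym; trans; cong; cong₂; subst; module ≡-Reasoning)

open ≡-Reasoning

double-injective : ∀ {a b} → a + a ≡ b + b → a ≡ b
double-injective {a} {b} e = *-cancelˡ-≡ a b 2 (begin
  2 * a      ≡⟨ solve (a ∷ []) ⟩
  a + a      ≡⟨ e ⟩
  b + b      ≡⟨ solve (b ∷ []) ⟩
  2 * b      ∎)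

square : ℕ → ℕ
square n = n * n

square-injective : ∀ {m n} → square m ≡ square n → m ≡ n
square-injective {m} {n} e with <-cmp m n
... | tri< m<n _ _ = ⊥-elim (<⇒≢ (*-mono-< m<n m<n) e)
... | tri≈ _ m≡n _ = m≡n
... | tri> _ _ n<m = ⊥-elim (<⇒≢ (*-mono-< n<m n<m) (sym e))

no-consecutive-squares : ∀ {m n} → 0 < m → suc (square m) ≢ square n
no-consecutive-squares {m} {n} 0<m e with <-cmp m n
... | tri< m<n _ _ = <⇒≢ (<-≤-trans gap (*-mono-≤ m<n m<n)) e
  where
  -- (m+1)² = m² + 1 + 2m exceeds m² + 1
  gap : suc (square m) < suc m * suc m
  gap = subst (suc (square m) <_) expand (m<m+n (suc (square m)) (+-mono-< 0<m 0<m))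
    where
    expand : suc (m * m) + (m + m) ≡ suc m * suc m
    expand = solve (m ∷ [])
... | tri≈ _ refl _ = 1+n≢n e
... | tri> _ _ n<m = <-asym (*-mono-< n<m n<m) (subst (square m <_) e (n<1+n (square m)))

small-avoids : ∀ {a n} → a < 15 → 4 ≤ n → a ≢ square n × suc a ≢ square n
small-avoids {a} {n} a<15 4≤n =
    <⇒≢ (<-≤-trans (<-trans a<15 (n<1+n 15)) 16≤n²)
  , <⇒≢ (<-≤-trans (s≤s a<15) 16≤n²)
  where
  16≤n² : 16 ≤ square n
  16≤n² = *-mono-≤ 4≤n 4≤n

square-form : ∀ J → suc (J * J + 8 * J + 15) ≡ (4 + J) * (4 + J)
square-form = solve-∀

head-below : ∀ {x xs} → Linked _<_ (x ∷ xs) → ∀ i → x < lookup xs i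
head-below (x<y Linked.∷ _)    Fin.zero    = x<y
head-below (x<y Linked.∷ rest) (Fin.suc i) = <-trans x<y (head-below rest i)

lookup-injective : ∀ {xs} → Linked _<_ xs → ∀ i j → lookup xs i ≡ lookup xs j → i ≡ j
lookup-injective {_ ∷ _} asc Fin.zero    Fin.zero    _ = refl
lookup-injective {_ ∷ _} asc Fin.zero    (Fin.suc j) e = ⊥-elim (<⇒≢ (head-below asc j) e)
lookup-injective {_ ∷ _} asc (Fin.suc i) Fin.zero    e = ⊥-elim (<⇒≢ (head-below asc i) (sym e))
lookup-injective {_ ∷ _} asc (Fin.suc i) (Fin.suc j) e =
  cong Fin.suc (lookup-injective (Linked.tail asc) i j e)

sumN : (ℕ → ℕ) → ℕ → ℕ
sumN f zero    = 0
sumN f (suc n) = f 0 + sumN (λ x → f (suc x)) n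

sumN-cong : ∀ {f g : ℕ → ℕ} n → (∀ x → f x ≡ g x) → sumN f n ≡ sumN g n
sumN-cong zero    f≗g = refl
sumN-cong (suc n) f≗g = cong₂ _+_ (f≗g 0) (sumN-cong n (λ x → f≗g (suc x)))

sumN-+ : ∀ (f g : ℕ → ℕ) n → sumN (λ x → f x + g x) n ≡ sumN f n + sumN g n
sumN-+ f g zero    = refl
sumN-+ f g (suc n) = begin
  f 0 + g 0 + sumN (λ x → f (suc x) + g (suc x)) n
    ≡⟨ cong (f 0 + g 0 +_) (sumN-+ (λ x → f (suc x)) (λ x → g (suc x)) n) ⟩
  f 0 + g 0 + (F + G)
    ≡⟨ interchange (f 0) (g 0) F G ⟩
  f 0 + F + (g 0 + G) ∎
  where
  F = sumN (λ x → f (suc x)) n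
  G = sumN (λ x → g (suc x)) n

sumN-const : ∀ c n → sumN (λ _ → c) n ≡ n * c
sumN-const c zero    = refl
sumN-const c (suc n) = cong (c +_) (sumN-const c n)

sumN-split : ∀ (f : ℕ → ℕ) a b → sumN f (a + b) ≡ sumN f a + sumN (λ x → f (a + x)) b
sumN-split f zero    b = refl
sumN-split f (suc a) b = trans (cong (f 0 +_) (sumN-split (λ x → f (suc x)) a b))
                               (sym (+-assoc (f 0) _ _))

T : ℕ → ℕ
T = sumN (λ x → x)

T-suc : ∀ n → T (suc n) ≡ n + T n
T-suc n = begin
  sumN (λ x → 1 + x) n             ≡⟨ sumN-+ (λ _ → 1) (λ x → x) n ⟩
  sumN (λ _ → 1) n + T n           ≡⟨ cong (_+ T n) (trans (sumN-const 1 n) (*-identityʳ n)) ⟩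
  n + T n                          ∎

-- 2·T n = n² - n, stated without subtraction.
T-double : ∀ n → T n + T n + n ≡ n * n
T-double zero    = refl
T-double (suc n) = begin
  T (suc n) + T (suc n) + suc n    ≡⟨ cong (λ t → t + t + suc n) (T-suc n) ⟩
  n + T n + (n + T n) + suc n      ≡⟨ regroup n (T n) ⟩
  1 + n + n + (T n + T n + n)      ≡⟨ cong (1 + n + n +_) (T-double n) ⟩
  1 + n + n + n * n                ≡⟨ solve (n ∷ []) ⟩
  suc n * suc n                    ∎
  where
  regroup : ∀ n t → n + t + (n + t) + suc n ≡ 1 + n + n + (t + t + n)
  regroup = solve-∀

T-suc-double : ∀ n → T (suc n) + T (suc n) ≡ n * suc n
T-suc-double n = +-cancelʳ-≡ (suc n) _ _ (begin
  T (suc n) + T (suc n) + suc n    ≡⟨ T-double (suc n) ⟩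
  suc n * suc n                    ≡⟨ +-comm (suc n) (n * suc n) ⟩
  n * suc n + suc n                ∎)

-- The contribution of a pendant path, seen from a vertex at distance c from
-- its attachment point:  Σ_{x<n} (x + 1 + c) = T n + n (c + 1).
sumN-offset : ∀ n c → sumN (λ x → suc x + c) n ≡ T n + n * suc c
sumN-offset n c = begin
  sumN (λ x → suc x + c) n                ≡⟨ sumN-cong n (λ x → sym (+-suc x c)) ⟩
  sumN (λ x → x + suc c) n                ≡⟨ sumN-+ (λ x → x) (λ _ → suc c) n ⟩
  T n + sumN (λ _ → suc c) n              ≡⟨ cong (T n +_) (sumN-const (suc c) n) ⟩
  T n + n * suc c                         ∎

devSum : ℕ → ℕ → ℕ
devSum J = sumN (λ x → ∣ x - J ∣)

devSum-left : ∀ J → devSum J J ≡ T (suc J)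
devSum-left zero    = refl
devSum-left (suc J) = begin
  suc J + devSum J J              ≡⟨ cong (suc J +_) (devSum-left J) ⟩
  suc J + T (suc J)               ≡⟨ sym (T-suc (suc J)) ⟩
  T (suc (suc J))                 ∎

devSum-split : ∀ J m → devSum J (suc (J + m)) ≡ T (suc J) + T (suc m)
devSum-split J m = begin
  devSum J (suc (J + m))                              ≡⟨ cong (devSum J) (sym (+-suc J m)) ⟩
  devSum J (J + suc m)                                ≡⟨ sumN-split _ J (suc m) ⟩
  devSum J J + sumN (λ x → ∣ J + x - J ∣) (suc m)     ≡⟨ cong₂ _+_ (devSum-left J) (sumN-cong (suc m) shift) ⟩
  T (suc J) + T (suc m)                               ∎
  where
  shift : ∀ x → ∣ J + x - J ∣ ≡ x
  shift x = trans (m≤n⇒∣n-m∣≡n∸m (m≤m+n J x)) (m+n∸m≡n J x)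

sum-allFin : ∀ n (f : ℕ → ℕ) → sum (map (λ i → f (toℕ i)) (allFin n)) ≡ sumN f n
sum-allFin n f = trans (cong sum (map-tabulate {n = n} (λ i → i) (λ i → f (toℕ i)))) (sum-tabulate n f)
  where
  sum-tabulate : ∀ n (f : ℕ → ℕ) → sum (tabulate {n = n} (λ i → f (toℕ i))) ≡ sumN f n
  sum-tabulate zero    f = refl
  sum-tabulate (suc n) f = cong (f 0 +_) (sum-tabulate n (λ x → f (suc x)))

sum-shift : ∀ {A : Set} {f g : A → ℕ} c {xs : List A} →
            All (λ x → f x ≡ g x + c) xs → sum (map f xs) ≡ sum (map g xs) + length xs * c
sum-shift c All.[] = refl
sum-shift {f = f} {g} c {x ∷ xs} (fx≡gx+c All.∷ rest) = begin
  f x + sum (map f xs)                             ≡⟨ cong₂ _+_ fx≡gx+c (sum-shift c rest) ⟩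
  g x + c + (sum (map g xs) + length xs * c)       ≡⟨ interchange (g x) c _ _ ⟩
  g x + sum (map g xs) + (c + length xs * c)       ∎

module _ {G : Graph} where

  _++ʷ_ : ∀ {u v w a b} → Walk G u v a → Walk G v w b → Walk G u w (a + b)
  nil      ++ʷ q = q
  cons e p ++ʷ q = cons e (p ++ʷ q)

  snocʷ : ∀ {u v w a} → Walk G u v a → Adj G v w → Walk G u w (suc a)
  snocʷ nil        e = cons e nil
  snocʷ (cons e p) f = cons e (snocʷ p f)

  reverseʷ : (∀ {x y} → Adj G x y → Adj G y x) → ∀ {u v a} → Walk G u v a → Walk G v u a
  reverseʷ sym-adj nil        = nil
  reverseʷ sym-adj (cons e p) = snocʷ (reverseʷ sym-adj p) (sym-adj e)

dT : Fin 3 → Fin 3 → ℕ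
dT 0F 0F = 0
dT 1F 1F = 0
dT 2F 2F = 0
dT _  _  = 1

dT-self : ∀ a → dT a a ≡ 0
dT-self 0F = refl
dT-self 1F = refl
dT-self 2F = refl

dT≤1 : ∀ a c → dT a c ≤ 1
dT≤1 0F 0F = z≤n
dT≤1 1F 1F = z≤n
dT≤1 2F 2F = z≤n
dT≤1 0F 1F = ≤-refl
dT≤1 0F 2F = ≤-refl
dT≤1 1F 0F = ≤-refl
dT≤1 1F 2F = ≤-refl
dT≤1 2F 0F = ≤-refl
dT≤1 2F 1F = ≤-refl

dT-step : ∀ n a b c → n + dT a c ≤ suc (n + dT b c)
dT-step n a b c =
  ≤-trans (+-monoʳ-≤ n (dT≤1 a c))              -- n + dT a c ≤ n + 1
    (≤-trans (≤-reflexive (+-comm n 1))          --          = suc n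
             (s≤s (m≤m+n n (dT b c))))           --          ≤ suc (n + dT b c)

∣-∣-step : ∀ a l → ∣ a - l ∣ ≤ suc ∣ suc a - l ∣ × ∣ suc a - l ∣ ≤ suc ∣ a - l ∣
∣-∣-step zero    zero    = z≤n , ≤-refl
∣-∣-step zero    (suc l) = ≤-refl , m≤n⇒m≤1+n (n≤1+n l)
∣-∣-step (suc a) zero    = m≤n⇒m≤1+n (n≤1+n (suc a)) , ≤-refl
∣-∣-step (suc a) (suc l) = ∣-∣-step a l

module PendantTriangle (len : Fin 5 → ℕ) where

  Γ : Graph
  Γ = record { V = VC3 len ; Adj = AdjC3 len ; vertices = verticesC3 len }

  Vertex : Set
  Vertex = VC3 len

  depth : Vertex → ℕ
  depth (inj₁ _)       = 0
  depth (inj₂ (_ , i)) = suc (toℕ i)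

  anchor : Vertex → Fin 3
  anchor (inj₁ a)       = a
  anchor (inj₂ (p , _)) = att p

  δ : Vertex → Vertex → ℕ
  δ (inj₁ a)       v              = depth v + dT a (anchor v)
  δ (inj₂ (p , i)) (inj₁ c)       = suc (toℕ i) + dT (att p) c
  δ (inj₂ (p , i)) (inj₂ (q , j)) =
    if does (p Fin.≟ q) then ∣ toℕ i - toℕ j ∣
    else suc (toℕ i) + suc (toℕ j) + dT (att p) (att q)

  δ-self : ∀ u → δ u u ≡ 0
  δ-self (inj₁ a)       = dT-self a
  δ-self (inj₂ (p , i)) with p Fin.≟ p
  ... | yes _  = m≡n⇒∣m-n∣≡0 {toℕ i} refl
  ... | no p≢p = ⊥-elim (p≢p refl)

  δ-edge : ∀ {u w} → EdgeC3 len u w → ∀ v → δ u v ≤ suc (δ w v) × δ w v ≤ suc (δ u v)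
  δ-edge tri01 v = dT-step (depth v) 0F 1F (anchor v) , dT-step (depth v) 1F 0F (anchor v)
  δ-edge tri12 v = dT-step (depth v) 1F 2F (anchor v) , dT-step (depth v) 2F 1F (anchor v)
  δ-edge tri02 v = dT-step (depth v) 0F 2F (anchor v) , dT-step (depth v) 2F 0F (anchor v)
  δ-edge (attach p i i≡0) (inj₁ c) rewrite i≡0 = m≤n⇒m≤1+n (n≤1+n _) , ≤-refl
  δ-edge (attach p i i≡0) (inj₂ (q , j)) with p Fin.≟ q
  ... | yes refl rewrite i≡0 | dT-self (att p) =
          ≤-reflexive (cong suc (+-identityʳ (toℕ j))) ,
          ≤-trans (m≤n⇒m≤1+n (n≤1+n (toℕ j))) (s≤s (s≤s (m≤m+n (toℕ j) 0)))
  ... | no _ rewrite i≡0 = m≤n⇒m≤1+n (n≤1+n _) , ≤-refl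
  δ-edge (step p i j i+1≡j) (inj₁ c) rewrite sym i+1≡j = m≤n⇒m≤1+n (n≤1+n _) , ≤-refl
  δ-edge (step p i j i+1≡j) (inj₂ (q , l)) with p Fin.≟ q
  ... | yes refl rewrite sym i+1≡j = ∣-∣-step (toℕ i) (toℕ l)
  ... | no _     rewrite sym i+1≡j = m≤n⇒m≤1+n (n≤1+n _) , ≤-refl

  δ-adjacent : ∀ {u w} → AdjC3 len u w → ∀ v → δ u v ≤ suc (δ w v)
  δ-adjacent (inj₁ e) v = proj₁ (δ-edge e v)
  δ-adjacent (inj₂ e) v = proj₂ (δ-edge e v)

  δ-lower : ∀ {u v ℓ} → Walk Γ u v ℓ → δ u v ≤ ℓ
  δ-lower {u} nil               = ≤-reflexive (δ-self u)
  δ-lower {v = v} (cons e walk) = ≤-trans (δ-adjacent e v) (s≤s (δ-lower walk))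

  adj-sym : ∀ {x y} → AdjC3 len x y → AdjC3 len y x
  adj-sym (inj₁ e) = inj₂ e
  adj-sym (inj₂ e) = inj₁ e

  descend : ∀ p n (i : Fin (len p)) → toℕ i ≡ n → Walk Γ (inj₂ (p , i)) (inj₁ (att p)) (suc n)
  descend p zero    i i≡0   = cons (inj₂ (attach p i i≡0)) nil
  descend p (suc n) i i≡1+n = cons (inj₂ (step p below i below+1≡i)) (descend p n below (toℕ-fromℕ< n<len))
    where
    n<len : n < len p
    n<len = ≤-<-trans (n≤1+n n) (subst (_< len p) i≡1+n (toℕ<n i))
    below : Fin (len p)
    below = fromℕ< n<len
    below+1≡i : suc (toℕ below) ≡ toℕ i
    below+1≡i = trans (cong suc (toℕ-fromℕ< n<len)) (sym i≡1+n)

  ascend : ∀ p d (i j : Fin (len p)) → toℕ i + d ≡ toℕ j → Walk Γ (inj₂ (p , i)) (inj₂ (p , j)) d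
  ascend p zero i j i+0≡j =
    subst (λ x → Walk Γ (inj₂ (p , i)) (inj₂ (p , x)) 0)
          (toℕ-injective (trans (sym (+-identityʳ (toℕ i))) i+0≡j)) nil
  ascend p (suc d) i j i+d+1≡j = cons (inj₁ (step p i next (sym (toℕ-fromℕ< next<len))))
                                      (ascend p d next j next+d≡j)
    where
    i+1≤j : suc (toℕ i) ≤ toℕ j
    i+1≤j = subst (suc (toℕ i) ≤_) (trans (sym (+-suc (toℕ i) d)) i+d+1≡j) (s≤s (m≤m+n (toℕ i) d))
    next<len : suc (toℕ i) < len p
    next<len = ≤-<-trans i+1≤j (toℕ<n j)
    next : Fin (len p)
    next = fromℕ< next<len
    next+d≡j : toℕ next + d ≡ toℕ j
    next+d≡j = trans (cong (_+ d) (toℕ-fromℕ< next<len)) (trans (sym (+-suc (toℕ i) d)) i+d+1≡j)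

  along : ∀ p (i j : Fin (len p)) → Walk Γ (inj₂ (p , i)) (inj₂ (p , j)) ∣ toℕ i - toℕ j ∣
  along p i j with ≤-total (toℕ i) (toℕ j)
  ... | inj₁ i≤j = subst (Walk Γ (inj₂ (p , i)) (inj₂ (p , j))) (sym (m≤n⇒∣m-n∣≡n∸m i≤j))
                         (ascend p _ i j (m+[n∸m]≡n i≤j))
  ... | inj₂ j≤i = subst (Walk Γ (inj₂ (p , i)) (inj₂ (p , j))) (sym (m≤n⇒∣n-m∣≡n∸m j≤i))
                         (reverseʷ adj-sym (ascend p _ j i (m+[n∸m]≡n j≤i)))

  across : ∀ a c → Walk Γ (inj₁ a) (inj₁ c) (dT a c)
  across 0F 0F = nil
  across 1F 1F = nil
  across 2F 2F = nil
  across 0F 1F = cons (inj₁ tri01) nil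
  across 1F 0F = cons (inj₂ tri01) nil
  across 1F 2F = cons (inj₁ tri12) nil
  across 2F 1F = cons (inj₂ tri12) nil
  across 0F 2F = cons (inj₁ tri02) nil
  across 2F 0F = cons (inj₂ tri02) nil

  shortest : ∀ u v → Walk Γ u v (δ u v)
  shortest (inj₁ a) (inj₁ c) = across a c
  shortest (inj₁ a) (inj₂ (q , j)) =
    subst (Walk Γ (inj₁ a) (inj₂ (q , j))) (+-comm (dT a (att q)) (suc (toℕ j)))
          (across a (att q) ++ʷ reverseʷ adj-sym (descend q _ j refl))
  shortest (inj₂ (p , i)) (inj₁ c) = descend p _ i refl ++ʷ across (att p) c
  shortest (inj₂ (p , i)) (inj₂ (q , j)) with p Fin.≟ q
  ... | yes refl = along p i j
  ... | no _     =
    subst (Walk Γ (inj₂ (p , i)) (inj₂ (q , j))) (xy∙z≈xz∙y (suc (toℕ i)) (dT (att p) (att q)) (suc (toℕ j)))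
          ((descend p _ i refl ++ʷ across (att p) (att q)) ++ʷ reverseʷ adj-sym (descend q _ j refl))

  δ-isDistance : IsDistanceFunction Γ δ
  δ-isDistance u v = record { walk = shortest u v ; shortest = δ-lower }

  distSum : Vertex → List Vertex → ℕ
  distSum v us = sum (map (λ u → δ u v) us)

  distSum-concat : ∀ v (uss : List (List Vertex)) → distSum v (concat uss) ≡ sum (map (distSum v) uss)
  distSum-concat v []         = refl
  distSum-concat v (us ∷ uss) = begin
    distSum v (us ++ concat uss)                  ≡⟨ cong sum (map-++ (λ u → δ u v) us (concat uss)) ⟩
    sum (map (λ u → δ u v) us ++ map _ (concat uss)) ≡⟨ sum-++ (map (λ u → δ u v) us) _ ⟩
    distSum v us + distSum v (concat uss)         ≡⟨ cong (distSum v us +_) (distSum-concat v uss) ⟩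
    distSum v us + sum (map (distSum v) uss)      ∎

  triangle : List Vertex
  triangle = map inj₁ (allFin 3)

  pathVertices : Fin 5 → List Vertex
  pathVertices p = map (λ i → inj₂ (p , i)) (allFin (len p))

  pathSum : Fin 5 → Vertex → ℕ
  pathSum p v = distSum v (pathVertices p)

  coreBlocks : List (List Vertex)
  coreBlocks = triangle ∷ pathVertices 0F ∷ pathVertices 1F ∷ pathVertices 3F ∷ []

  core : List Vertex
  core = concat coreBlocks

  Tr-split : ∀ v → Tr Γ δ v ≡ distSum v core + pathSum 2F v + pathSum 4F v
  Tr-split v = begin
    Tr Γ δ v                                    ≡⟨ distSum-concat v (triangle ∷ map pathVertices (allFin 5)) ⟩
    t + (d₀ + (d₁ + (d₂ + (d₃ + (d₄ + 0)))))    ≡⟨ regroup t d₀ d₁ d₂ d₃ d₄ ⟩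
    t + (d₀ + (d₁ + (d₃ + 0))) + d₂ + d₄        ≡⟨ cong (λ c → c + d₂ + d₄) (sym (distSum-concat v coreBlocks)) ⟩
    distSum v core + d₂ + d₄                    ∎
    where
    t  = distSum v triangle
    d₀ = pathSum 0F v
    d₁ = pathSum 1F v
    d₂ = pathSum 2F v
    d₃ = pathSum 3F v
    d₄ = pathSum 4F v
    regroup : ∀ t d₀ d₁ d₂ d₃ d₄ → t + (d₀ + (d₁ + (d₂ + (d₃ + (d₄ + 0))))) ≡ t + (d₀ + (d₁ + (d₃ + 0))) + d₂ + d₄
    regroup = solve-∀

  pathSum-via : ∀ p v (f : ℕ → ℕ) → (∀ i → δ (inj₂ (p , i)) v ≡ f (toℕ i)) → pathSum p v ≡ sumN f (len p)
  pathSum-via p v f δ≡f = begin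
    sum (map (λ u → δ u v) (map (λ i → inj₂ (p , i)) (allFin (len p))))
      ≡⟨ cong sum (sym (map-∘ (allFin (len p)))) ⟩
    sum (map (λ i → δ (inj₂ (p , i)) v) (allFin (len p)))
      ≡⟨ cong sum (map-cong δ≡f (allFin (len p))) ⟩
    sum (map (λ i → f (toℕ i)) (allFin (len p)))
      ≡⟨ sum-allFin (len p) f ⟩
    sumN f (len p) ∎

  NotOn : Fin 5 → Vertex → Set
  NotOn p (inj₁ _)       = ⊤
  NotOn p (inj₂ (q , _)) = ¬ p ≡ q

  -- Path p is pendant: every route between it and a vertex off it passes att p.
  δ-from-path : ∀ p i v → NotOn p v → δ (inj₂ (p , i)) v ≡ suc (toℕ i) + δ (inj₁ (att p)) v
  δ-from-path p i (inj₁ c) _ = refl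
  δ-from-path p i (inj₂ (q , j)) p≢q with p Fin.≟ q
  ... | yes p≡q = ⊥-elim (p≢q p≡q)
  ... | no _    = +-assoc (suc (toℕ i)) (suc (toℕ j)) (dT (att p) (att q))

  δ-to-path : ∀ p j u → NotOn p u → δ u (inj₂ (p , j)) ≡ δ u (inj₁ (att p)) + suc (toℕ j)
  δ-to-path p j (inj₁ a) _ = +-comm (suc (toℕ j)) (dT a (att p))
  δ-to-path p j (inj₂ (q , i)) p≢q with q Fin.≟ p
  ... | yes q≡p = ⊥-elim (p≢q (sym q≡p))
  ... | no _    = xy∙z≈xz∙y (suc (toℕ i)) (suc (toℕ j)) (dT (att q) (att p))

  pathSum-off : ∀ p v → NotOn p v → pathSum p v ≡ T (len p) + len p * suc (δ (inj₁ (att p)) v)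
  pathSum-off p v off = trans (pathSum-via p v (λ x → suc x + δ (inj₁ (att p)) v) (λ i → δ-from-path p i v off))
                              (sumN-offset (len p) (δ (inj₁ (att p)) v))

  pathSum-on : ∀ p j → pathSum p (inj₂ (p , j)) ≡ devSum (toℕ j) (len p)
  pathSum-on p j = pathSum-via p (inj₂ (p , j)) (λ x → ∣ x - toℕ j ∣) on-path
    where
    on-path : ∀ i → δ (inj₂ (p , i)) (inj₂ (p , j)) ≡ ∣ toℕ i - toℕ j ∣
    on-path i with p Fin.≟ p
    ... | yes _  = refl
    ... | no p≢p = ⊥-elim (p≢p refl)

  distSum-shift : ∀ p j {us} → All (NotOn p) us →
                  distSum (inj₂ (p , j)) us ≡ distSum (inj₁ (att p)) us + length us * suc (toℕ j)
  distSum-shift p j off = sum-shift (suc (toℕ j)) (All.map (δ-to-path p j _) off)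

  Tr-off-long : ∀ v → NotOn 2F v → NotOn 4F v →
    Tr Γ δ v ≡ distSum v core + (T (len 2F) + len 2F * suc (δ (inj₁ 1F) v))
                              + (T (len 4F) + len 4F * suc (δ (inj₁ 2F) v))
  Tr-off-long v off₂ off₄ = trans (Tr-split v) (cong₂ (λ x y → distSum v core + x + y)
                                                      (pathSum-off 2F v off₂) (pathSum-off 4F v off₄))

-- Twice the deviation sum: 2·Σ_{x<k} |x - J| = J(J+1) + (k-J-1)(k-J), written
-- without subtraction.
devSum-double : ∀ {J k} → J < k → devSum J k + devSum J k + k * (2 * J + 1) ≡ 2 * (J * suc J) + k * k
devSum-double {J} {k} J<k =
  subst (λ k → devSum J k + devSum J k + k * (2 * J + 1) ≡ 2 * (J * suc J) + k * k)
        (m+[n∸m]≡n J<k) (split-form (k ∸ suc J))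
  where
  halves : ∀ m a b → a + a ≡ J * suc J → b + b ≡ m * suc m →
           (a + b) + (a + b) + suc (J + m) * (2 * J + 1) ≡ 2 * (J * suc J) + suc (J + m) * suc (J + m)
  halves m a b 2a 2b = begin
    (a + b) + (a + b) + suc (J + m) * (2 * J + 1)        ≡⟨ solve (J ∷ m ∷ a ∷ b ∷ []) ⟩
    (a + a) + (b + b) + suc (J + m) * (2 * J + 1)        ≡⟨ cong₂ (λ x y → x + y + suc (J + m) * (2 * J + 1)) 2a 2b ⟩
    J * suc J + m * suc m + suc (J + m) * (2 * J + 1)    ≡⟨ solve (J ∷ m ∷ []) ⟩
    2 * (J * suc J) + suc (J + m) * suc (J + m)          ∎
  split-form : ∀ m → devSum J (suc (J + m)) + devSum J (suc (J + m)) + suc (J + m) * (2 * J + 1)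
                     ≡ 2 * (J * suc J) + suc (J + m) * suc (J + m)
  split-form m rewrite devSum-split J m = halves m (T (suc J)) (T (suc m)) (T-suc-double J) (T-suc-double m)

-- A vertex off the two long paths, with distance sum n to the core and at
-- distances a-1, b-1 from their attachment vertices (t = T k, see Tr-off-long),
-- has transmission (k+1)² + c provided n + k(a+b) = 3k + 1 + c.
core-closed : ∀ {k t} → t + t + k ≡ k * k → ∀ n a b c → n + k * (a + b) ≡ suc (3 * k + c) →
             n + (t + k * a) + (t + k * b) ≡ suc k * suc k + c
core-closed {k} {t} 2t+k n a b c balance = +-cancelʳ-≡ k _ _ (begin
  n + (t + k * a) + (t + k * b) + k         ≡⟨ solve (k ∷ t ∷ n ∷ a ∷ b ∷ []) ⟩
  n + k * (a + b) + (t + t + k)             ≡⟨ cong₂ _+_ balance 2t+k ⟩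
  suc (3 * k + c) + k * k                   ≡⟨ solve (k ∷ c ∷ []) ⟩
  suc k * suc k + c + k                     ∎)

-- The vertex at depth J+1 of a long path: its distance sum to the core is
-- 9 + 7(J+1) (plus one on the path attached at 1F), s is the deviation sum
-- along its own path, and t + k(J+3) with t = T k the contribution of the other
-- long path.  The total is (k+1)² + (J+4)² - 1.
long-closed : ∀ k J s t → s + s + k * (2 * J + 1) ≡ 2 * (J * suc J) + k * k → t + t + k ≡ k * k →
              9 + 7 * suc J + (s + (t + k * suc (suc J + 1))) ≡ suc k * suc k + (J * J + 8 * J + 15)
long-closed k J s t 2s 2t+k = double-injective (+-cancelʳ-≡ (k * (2 * J + 1) + k) _ _ (begin
  9 + 7 * suc J + (s + (t + k * suc (suc J + 1))) + (9 + 7 * suc J + (s + (t + k * suc (suc J + 1))))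
    + (k * (2 * J + 1) + k)
      ≡⟨ solve (k ∷ J ∷ s ∷ t ∷ []) ⟩
  32 + 14 * J + (s + s + k * (2 * J + 1)) + (t + t + k) + 2 * k * (J + 3)
      ≡⟨ cong₂ (λ x y → 32 + 14 * J + x + y + 2 * k * (J + 3)) 2s 2t+k ⟩
  32 + 14 * J + (2 * (J * suc J) + k * k) + k * k + 2 * k * (J + 3)
      ≡⟨ solve (k ∷ J ∷ []) ⟩
  suc k * suc k + (J * J + 8 * J + 15) + (suc k * suc k + (J * J + 8 * J + 15)) + (k * (2 * J + 1) + k)
      ∎))

module C3-1-1k-2k (k : ℕ) where

  open PendantTriangle (lenC3 1 1 k 2 k) public

  K : ℕ
  K = suc k * suc k

  -- The seven core vertices, ranked by transmission, and the two long paths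
  -- (attached at 1F and at 2F).
  data Position : Set where
    core-vertex : Fin 7 → Position
    on-path₂    : Fin k → Position
    on-path₄    : Fin k → Position

  position : Vertex → Position
  position (inj₁ 0F)        = core-vertex 2F
  position (inj₁ 1F)        = core-vertex 1F
  position (inj₁ 2F)        = core-vertex 0F
  position (inj₂ (0F , 0F)) = core-vertex 5F
  position (inj₂ (1F , 0F)) = core-vertex 4F
  position (inj₂ (2F , j))  = on-path₂ j
  position (inj₂ (3F , 0F)) = core-vertex 3F
  position (inj₂ (3F , 1F)) = core-vertex 6F
  position (inj₂ (4F , j))  = on-path₄ j

  vertexAt : Position → Vertex
  vertexAt (core-vertex 0F) = inj₁ 2F
  vertexAt (core-vertex 1F) = inj₁ 1F
  vertexAt (core-vertex 2F) = inj₁ 0F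
  vertexAt (core-vertex 3F) = inj₂ (3F , 0F)
  vertexAt (core-vertex 4F) = inj₂ (1F , 0F)
  vertexAt (core-vertex 5F) = inj₂ (0F , 0F)
  vertexAt (core-vertex 6F) = inj₂ (3F , 1F)
  vertexAt (on-path₂ j)     = inj₂ (2F , j)
  vertexAt (on-path₄ j)     = inj₂ (4F , j)

  vertexAt-position : ∀ v → vertexAt (position v) ≡ v
  vertexAt-position (inj₁ 0F)        = refl
  vertexAt-position (inj₁ 1F)        = refl
  vertexAt-position (inj₁ 2F)        = refl
  vertexAt-position (inj₂ (0F , 0F)) = refl
  vertexAt-position (inj₂ (1F , 0F)) = refl
  vertexAt-position (inj₂ (2F , j))  = refl
  vertexAt-position (inj₂ (3F , 0F)) = refl
  vertexAt-position (inj₂ (3F , 1F)) = refl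
  vertexAt-position (inj₂ (4F , j))  = refl

  position-injective : ∀ {u v} → position u ≡ position v → u ≡ v
  position-injective {u} {v} e =
    trans (sym (vertexAt-position u)) (trans (cong vertexAt e) (vertexAt-position v))

  -- Transmissions minus K: the core values are 8 ∷ 9 ∷ A₀ in rank order.
  coreValues : List ℕ
  coreValues = 8 ∷ 9 ∷ A0 k

  value : Position → ℕ
  value (core-vertex r) = lookup coreValues r
  value (on-path₂ j)    = square (4 + toℕ j)
  value (on-path₄ j)    = pred (square (4 + toℕ j))

  core-off : ∀ p → p ≢ 0F → p ≢ 1F → p ≢ 3F → All (NotOn p) core
  core-off p p≢0 p≢1 p≢3 =
    tt All.∷ tt All.∷ tt All.∷ p≢0 All.∷ p≢1 All.∷ p≢3 All.∷ p≢3 All.∷ All.[]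

  -- Core vertices: Tr-off-long with the numerals
  -- (core distance sum, a, b) read off the graph; long paths: shift the core
  -- sum from the attachment vertex, then long-closed.
  transmission : ∀ v → Tr Γ δ v ≡ K + value (position v)
  transmission (inj₁ 0F)        = trans (Tr-off-long (inj₁ 0F) tt tt)
                                        (core-closed {k} {T k} (T-double k) 10 2 2 (k + 9) (solve (k ∷ [])))
  transmission (inj₁ 1F)        = trans (Tr-off-long (inj₁ 1F) tt tt)
                                        (core-closed {k} {T k} (T-double k) 10 1 2 9 (solve (k ∷ [])))
  transmission (inj₁ 2F)        = trans (Tr-off-long (inj₁ 2F) tt tt)
                                        (core-closed {k} {T k} (T-double k) 9 2 1 8 (solve (k ∷ [])))
  transmission (inj₂ (0F , 0F)) = trans (Tr-off-long (inj₂ (0F , 0F)) (λ ()) (λ ()))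
                                        (core-closed {k} {T k} (T-double k) 15 3 3 (3 * k + 14) (solve (k ∷ [])))
  transmission (inj₂ (1F , 0F)) = trans (Tr-off-long (inj₂ (1F , 0F)) (λ ()) (λ ()))
                                        (core-closed {k} {T k} (T-double k) 15 2 3 (2 * k + 14) (solve (k ∷ [])))
  transmission (inj₂ (3F , 0F)) = trans (Tr-off-long (inj₂ (3F , 0F)) (λ ()) (λ ()))
                                        (core-closed {k} {T k} (T-double k) 12 3 2 (2 * k + 11) (solve (k ∷ [])))
  transmission (inj₂ (3F , 1F)) = trans (Tr-off-long (inj₂ (3F , 1F)) (λ ()) (λ ()))
                                        (core-closed {k} {T k} (T-double k) 17 4 3 (4 * k + 16) (solve (k ∷ [])))
  transmission (inj₂ (2F , j))  = begin
    Tr Γ δ v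
      ≡⟨ Tr-split v ⟩
    distSum v core + pathSum 2F v + pathSum 4F v
      ≡⟨ cong₂ _+_ (cong₂ _+_ (distSum-shift 2F j (core-off 2F (λ ()) (λ ()) (λ ()))) (pathSum-on 2F j))
                   (pathSum-off 4F v (λ ())) ⟩
    10 + 7 * suc J + devSum J k + (T k + k * suc (suc J + 1))
      ≡⟨ +-assoc (10 + 7 * suc J) _ _ ⟩
    suc (9 + 7 * suc J + (devSum J k + (T k + k * suc (suc J + 1))))
      ≡⟨ cong suc (long-closed k J (devSum J k) (T k) (devSum-double (toℕ<n j)) (T-double k)) ⟩
    suc (K + (J * J + 8 * J + 15))
      ≡⟨ sym (+-suc K _) ⟩
    K + suc (J * J + 8 * J + 15)
      ≡⟨ cong (K +_) (square-form J) ⟩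
    K + square (4 + J) ∎
    where
    v = inj₂ (2F , j)
    J = toℕ j
  transmission (inj₂ (4F , j))  = begin
    Tr Γ δ v
      ≡⟨ Tr-split v ⟩
    distSum v core + pathSum 2F v + pathSum 4F v
      ≡⟨ cong₂ _+_ (cong₂ _+_ (distSum-shift 4F j (core-off 4F (λ ()) (λ ()) (λ ()))) (pathSum-off 2F v (λ ())))
                   (pathSum-on 4F j) ⟩
    9 + 7 * suc J + (T k + k * suc (suc J + 1)) + devSum J k
      ≡⟨ xy∙z≈x∙zy (9 + 7 * suc J) _ _ ⟩
    9 + 7 * suc J + (devSum J k + (T k + k * suc (suc J + 1)))
      ≡⟨ long-closed k J (devSum J k) (T k) (devSum-double (toℕ<n j)) (T-double k) ⟩
    K + (J * J + 8 * J + 15)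
      ≡⟨ cong (λ x → K + pred x) (square-form J) ⟩
    K + pred (square (4 + J)) ∎
    where
    v = inj₂ (4F , j)
    J = toℕ j

  coreValues-increasing : 0 < k → Linked _<_ coreValues
  coreValues-increasing 0<k =
            n<1+n 8                                            --  8 < 9
    Linked.∷ +-monoˡ-< 9 0<k                                   --  9 < k + 9
    Linked.∷ +-mono-≤-< (m≤m+n k (k + 0)) (m<m+n 9 z<s)        --  k + 9 < 2k + 11
    Linked.∷ +-monoʳ-< (2 * k) (m<m+n 11 z<s)                  -- 2k + 11 < 2k + 14
    Linked.∷ +-monoˡ-< 14 (m<n+m (2 * k) 0<k)                  -- 2k + 14 < 3k + 14
    Linked.∷ +-mono-≤-< (m≤n+m (3 * k) k) (m<m+n 14 z<s)       -- 3k + 14 < 4k + 16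
    Linked.∷ Linked.[-]

  NoSquaresInA : Set
  NoSquaresInA = ∀ a → a ∈ Aset k → ∀ i → 3 ≤ i → i ≤ k + 3 → ¬ (a ≡ i * i)

  -- Neither a core value nor its successor is a square n² with 4 ≤ n ≤ k+3:
  -- 8 and 9 are too small, and the other core values lie in A₀ (their successors in A₀+1).
  core-avoids : NoSquaresInA → ∀ r {n} → 4 ≤ n → n ≤ k + 3 →
                lookup coreValues r ≢ square n × suc (lookup coreValues r) ≢ square n
  core-avoids H 0F            4≤n _   = small-avoids (m<m+n 8 z<s) 4≤n
  core-avoids H 1F            4≤n _   = small-avoids (m<m+n 9 z<s) 4≤n
  core-avoids H (Fin.suc (Fin.suc r)) {n} 4≤n n≤k+3 =
      (λ e → H a (∈-++⁺ˡ a∈A₀) n 3≤n n≤k+3 e)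
    , (λ e → H (suc a) (∈-++⁺ʳ (A0 k) (∈-map⁺ suc a∈A₀)) n 3≤n n≤k+3 e)
    where
    a    = lookup (A0 k) r
    a∈A₀ : a ∈ A0 k
    a∈A₀ = ∈-lookup r
    3≤n : 3 ≤ n
    3≤n = ≤-trans (n≤1+n 3) 4≤n


  index-low : (j : Fin k) → 4 ≤ 4 + toℕ j
  index-low j = m≤m+n 4 (toℕ j)

  index-high : (j : Fin k) → 4 + toℕ j ≤ k + 3
  index-high j = subst (4 + toℕ j ≤_) (+-comm 3 k) (+-monoʳ-≤ 3 (toℕ<n j))

  index-injective : ∀ {j j' : Fin k} → 4 + toℕ j ≡ 4 + toℕ j' → j ≡ j'
  index-injective e = toℕ-injective (+-cancelˡ-≡ 4 _ _ e)

  value-injective : 0 < k → NoSquaresInA → ∀ x y → value x ≡ value y → x ≡ y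
  value-injective 0<k H (core-vertex r) (core-vertex r') e =
    cong core-vertex (lookup-injective (coreValues-increasing 0<k) r r' e)
  value-injective 0<k H (core-vertex r) (on-path₂ j) e =
    ⊥-elim (proj₁ (core-avoids H r (index-low j) (index-high j)) e)
  value-injective 0<k H (on-path₂ j) (core-vertex r) e =
    ⊥-elim (proj₁ (core-avoids H r (index-low j) (index-high j)) (sym e))
  value-injective 0<k H (core-vertex r) (on-path₄ j) e =
    ⊥-elim (proj₂ (core-avoids H r (index-low j) (index-high j)) (cong suc e))
  value-injective 0<k H (on-path₄ j) (core-vertex r) e =
    ⊥-elim (proj₂ (core-avoids H r (index-low j) (index-high j)) (cong suc (sym e)))
  value-injective 0<k H (on-path₂ j) (on-path₂ j') e =
    cong on-path₂ (index-injective (square-injective e))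
  value-injective 0<k H (on-path₄ j) (on-path₄ j') e =
    cong on-path₄ (index-injective (square-injective (cong suc e)))
  value-injective 0<k H (on-path₂ j) (on-path₄ j') e =
    ⊥-elim (no-consecutive-squares {4 + toℕ j} {4 + toℕ j'} z<s (cong suc e))
  value-injective 0<k H (on-path₄ j) (on-path₂ j') e =
    ⊥-elim (no-consecutive-squares {4 + toℕ j'} {4 + toℕ j} z<s (cong suc (sym e)))

proposition4p1 : (k : ℕ) → 3 ≤ k →
    (∀ a → a ∈ Aset k → ∀ i → 3 ≤ i → i ≤ k + 3 → ¬ (a ≡ i * i)) →
    TransmissionIrregular (C3 1 1 k 2 k)
proposition4p1 k 3≤k noSquares = δ , δ-isDistance , irregular
  where
  open C3-1-1k-2k k

  irregular : TransmissionIrregularWrt (C3 1 1 k 2 k) δ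
  irregular u v Tu≡Tv = position-injective (value-injective (≤-trans z<s 3≤k) noSquares _ _
    (+-cancelˡ-≡ K _ _ (begin
      K + value (position u)   ≡⟨ sym (transmission u) ⟩
      Tr Γ δ u                 ≡⟨ Tu≡Tv ⟩
      Tr Γ δ v                 ≡⟨ transmission v ⟩
      K + value (position v)   ∎)))
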